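{- If a graph $G$ is ugly, then $\chi^\Sigma_g(G)\geq \chi(G)+1$.
   Context: All groups are Abelian, written additively with neutral element $0$. For a graph $G$ and an Abelian group $\mathcal{G}$, an edge labelling $f:E(G)\to\mathcal{G}$ defines the weighted degree $w(v)=\sum_{e\ni v} f(e)$ of each vertex $v$. The labelling $f$ is called vertex-$\mathcal{G}$-colouring if $w(u)\neq w(v)$ for every edge $uv$ of $G$. The group sum chromatic number $\chi^\Sigma_g(G)$ is the smallest integer $s$ such that for every Abelian group $\mathcal{G}$ of order $s$ there exists a vertex-$\mathcal{G}$-colouring labelling $f:E(G)\to\mathcal{G}$. $\chi(G)$ denotes the ordinary chromatic number. A colour class is odd (even) if it has odd (even) cardinality. A connected graph $G$ of order at least $3$ is called ugly if either (i) $\chi(G)=4k+2$ for some integer $k\geq 0$ and in every proper $\chi(G)$-colouring of $G$ all colour classes are odd, or (ii) $\chi(G)=2^q$ for some integer $q\geq 2$ and in every proper $\chi(G)$-colouring of $G$ either exactly $2$ or exactly $2^q-2$ colour classes are odd. -}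

module Defs where

open import Level using (0ℓ)
open import Data.Nat using (ℕ; zero; suc; _+_; _*_; _^_; _≤_; _%_)
open import Data.Fin using (Fin)
open import Data.Fin.Properties using (_≟_)
open import Data.Bool using (Bool; true; false; if_then_else_)
open import Data.List using (List; foldr; length; filterᵇ; allFin)
open import Data.Product using (Σ; _×_; ∃; ∃-syntax)
open import Data.Sum using (_⊎_)
open import Relation.Nullary using (¬_)
open import Relation.Nullary.Decidable using (⌊_⌋)
open import Relation.Binary.PropositionalEquality using (_≡_; setoid)
open import Algebra.Bundles using (AbelianGroup)
open import Function.Bundles using (Inverse)

record Graph (n : ℕ) : Set where
  field
    adj   : Fin n → Fin n → Bool
    sym   : ∀ u v → adj u v ≡ adj v u
    irrfl : ∀ v → adj v v ≡ false
open Graph public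

module _ {n : ℕ} (G : Graph n) where

  Adj : Fin n → Fin n → Set
  Adj u v = adj G u v ≡ true

  data Reach : Fin n → Fin n → Set where
    here : ∀ {v} → Reach v v
    step : ∀ {u v w} → Adj u v → Reach v w → Reach u w

  Connected : Set
  Connected = ∀ u v → Reach u v

  Proper : (k : ℕ) → (Fin n → Fin k) → Set
  Proper k c = ∀ u v → Adj u v → ¬ (c u ≡ c v)

  Colourable : ℕ → Set
  Colourable k = Σ (Fin n → Fin k) (Proper k)

  IsChromaticNumber : ℕ → Set
  IsChromaticNumber k = Colourable k × (∀ m → Colourable m → k ≤ m)

  classSize : {k : ℕ} → (Fin n → Fin k) → Fin k → ℕ
  classSize c i = length (filterᵇ (λ v → ⌊ c v ≟ i ⌋) (allFin n))

  oddClasses : {k : ℕ} → (Fin n → Fin k) → ℕ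
  oddClasses {k} c = length (filterᵇ (λ i → ⌊ classSize c i % 2 Data.Nat.≟ 1 ⌋) (allFin k))

  Ugly : Set
  Ugly = Connected × 3 ≤ n × ∃[ χ ] (IsChromaticNumber χ ×
           ( (∃[ j ] χ ≡ 4 * j + 2 ×
               (∀ c → Proper χ c → ∀ i → classSize c i % 2 ≡ 1))
           ⊎ (∃[ q ] 2 ≤ q × χ ≡ 2 ^ q ×
               (∀ c → Proper χ c → oddClasses c ≡ 2 ⊎ oddClasses c ≡ 2 ^ q Data.Nat.∸ 2))))

  module _ (A : AbelianGroup 0ℓ 0ℓ) where
    open AbelianGroup A

    -- an edge labelling, encoded as a symmetric function on pairs of vertices
    -- (only the values on adjacent pairs are relevant)
    record Labelling : Set where
      field
        lab     : Fin n → Fin n → Carrier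
        lab-sym : ∀ u v → lab u v ≈ lab v u

    weight : Labelling → Fin n → Carrier
    weight f v = foldr (λ u acc → (if adj G v u then Labelling.lab f v u else ε) ∙ acc) ε (allFin n)

    IsVertexColouring : Labelling → Set
    IsVertexColouring f = ∀ u v → Adj u v → ¬ (weight f u ≈ weight f v)

  HasOrder : AbelianGroup 0ℓ 0ℓ → ℕ → Set
  HasOrder A s = Inverse (AbelianGroup.setoid A) (setoid (Fin s))

  GoodOrder : ℕ → Set₁
  GoodOrder s = (A : AbelianGroup 0ℓ 0ℓ) → HasOrder A s →
                Σ (Labelling A) (IsVertexColouring A)

  IsGroupSumChromaticNumber : ℕ → Set₁
  IsGroupSumChromaticNumber s = 1 ≤ s × GoodOrder s × (∀ t → 1 ≤ t → GoodOrder t → s ≤ t)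

-- A labelling f over an Abelian group A of order s turns the weights w : V → A, read as
-- colours in Fin s, into a proper colouring whenever f is vertex-colouring; so s ≥ χ(G).
-- For a homomorphism φ : A → ℤ/2, each label f(uv) enters both w(u) and w(v), hence
-- Σ_v φ(w(v)) = 0; grouping the vertices by colour, φ vanishes on the sum of the colours
-- whose class is odd.  For an ugly G this rules out s = χ(G).  If χ = 4k+2, take A = ℤ/χ
-- and φ = parity: every colour has an odd class, and ℤ/χ has 2k+1 odd residues.  If
-- χ = 2^q, take A = (ℤ/2)^q and φ the coordinates: the odd classes, or the even ones since
-- the elements of (ℤ/2)^q add up to 0 for q ≥ 2, are two colours a ≠ b with a + b = 0.
module Submission where

open import Level using (0ℓ)
open import Algebra.Bundles using (AbelianGroup)
import Algebra.Construct.Pointwise as Pointwise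
open import Algebra.Morphism.Structures using (module MonoidMorphisms)
open import Data.Bool.Base using (Bool; true; false; not; if_then_else_)
import Data.Fin.Base as Fin
open import Data.Fin.Base using (Fin; zero; suc; toℕ; _↑ˡ_; _↑ʳ_; combine; finToFun; funToFin)
open import Data.Fin.Properties
  using (_≟_; toℕ-injective; toℕ-fromℕ<; toℕ<n; remQuot-combine; funToFin-finToFin; finToFun-funToFin)
open import Data.List.Base using (List; []; _∷_; length; foldr; filterᵇ; tabulate; allFin)
open import Data.List.Properties using (length-tabulate)
import Data.List.Relation.Unary.AllPairs as AllPairs
import Data.List.Relation.Unary.All as All
open import Data.List.Relation.Unary.Unique.Propositional.Properties using (allFin⁺; filter⁺)
open import Data.Nat.Base as ℕ using (ℕ; zero; suc; _≤_; _∸_; _^_; NonZero; parity; s≤s; z≤n)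
import Data.Nat.Properties as ℕₚ
open import Data.Nat.DivMod
  using (_%_; _/_; _mod_; m≡m%n+[m/n]*n; m%n<n; m*n%n≡0; %-distribˡ-+; %-distribˡ-*; m<n⇒m%n≡m; m%n%n≡m%n)
open import Data.Parity.Base as ℙ using (Parity; 0ℙ; 1ℙ; _⁻¹; _+_; _*_)
import Data.Parity.Properties as ℙₚ
open import Algebra.Properties.Semiring.Sum ℙₚ.+-*-semiring
  using (sum-syntax; sum-cong-≗; sum-replicate-zero; ∑-comm; ∑-distrib-+; *-distribˡ-sum)
open import Data.Product.Base using (∃₂; ∃-syntax; _×_; _,_; proj₁; proj₂)
open import Data.Sum.Base using (_⊎_; inj₁; inj₂)
open import Function.Base using (_∘_; id)
open import Function.Bundles using (Inverse; Injection)
open import Function.Properties.Inverse using (Inverse⇒Injection)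
import Function.Construct.Symmetry as Symmetry
open import Relation.Binary.PropositionalEquality
  using (_≡_; _≢_; refl; sym; trans; cong; cong₂; subst; setoid; module ≡-Reasoning)
open import Relation.Nullary.Decidable using (⌊_⌋; yes; no; T?)
open import Relation.Nullary.Negation using (¬_)

open import Defs hiding (sym)

open ≡-Reasoning

-- In Data.Parity, _+_ and _*_ are both infixl 7: x + (x * y) needs its parentheses.

toParity : Bool → Parity
toParity false = 0ℙ
toParity true  = 1ℙ

+≡0ℙ⇒≡ : ∀ {p q} → p + q ≡ 0ℙ → p ≡ q
+≡0ℙ⇒≡ {p} {q} eq = ℙₚ.+-cancelʳ-≡ q p q (trans eq (sym (ℙₚ.p+p≡0ℙ q)))

parity-% : ∀ m n .{{_ : NonZero n}} → parity n ≡ 0ℙ → parity (m % n) ≡ parity m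
parity-% m n even = sym (begin
  parity m                              ≡⟨ cong parity (m≡m%n+[m/n]*n m n) ⟩
  parity (m % n ℕ.+ m / n ℕ.* n)        ≡⟨ ℙₚ.+-homo-+ (m % n) (m / n ℕ.* n) ⟩
  parity (m % n) + parity (m / n ℕ.* n) ≡⟨ cong (λ p → parity (m % n) + p) multiple-even ⟩
  parity (m % n) + 0ℙ                   ≡⟨ ℙₚ.+-identityʳ (parity (m % n)) ⟩
  parity (m % n)                        ∎)
  where
  multiple-even : parity (m / n ℕ.* n) ≡ 0ℙ
  multiple-even = trans (ℙₚ.*-homo-* (m / n) n)
                        (trans (cong (λ p → parity (m / n) * p) even) (ℙₚ.*-zeroʳ (parity (m / n))))

toParity-odd : ∀ m → toParity ⌊ m % 2 ℕₚ.≟ 1 ⌋ ≡ parity m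
toParity-odd m with m % 2 | m%n<n m 2 | parity-% m 2 refl
... | 0           | _                  | eq = eq
... | 1           | _                  | eq = eq
... | suc (suc _) | s≤s (s≤s ())       | _

odd⇒parity≡1ℙ : ∀ m → m % 2 ≡ 1 → parity m ≡ 1ℙ
odd⇒parity≡1ℙ m m%2≡1 = trans (sym (parity-% m 2 refl)) (cong parity m%2≡1)

parity-2^suc : ∀ q → parity (2 ^ suc q) ≡ 0ℙ
parity-2^suc q = ℙₚ.*-homo-* 2 (2 ^ q)

2≤2^suc : ∀ q → 2 ≤ 2 ^ suc q
2≤2^suc q = ℕₚ.*-monoʳ-≤ 2 (ℕₚ.m^n>0 2 q)

∑-↑ : ∀ m n (f : Fin (m ℕ.+ n) → Parity) →
      ∑[ i < m ℕ.+ n ] f i ≡ ∑[ i < m ] f (i ↑ˡ n) + ∑[ i < n ] f (m ↑ʳ i)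
∑-↑ zero    n f = refl
∑-↑ (suc m) n f = trans (cong (f zero +_) (∑-↑ m n (f ∘ suc))) (sym (ℙₚ.+-assoc (f zero) _ _))

∑-combine : ∀ m n (f : Fin (m ℕ.* n) → Parity) →
            ∑[ i < m ℕ.* n ] f i ≡ ∑[ a < m ] ∑[ b < n ] f (combine a b)
∑-combine zero    n f = refl
∑-combine (suc m) n f =
  trans (∑-↑ n (m ℕ.* n) f) (cong (∑[ b < n ] f (combine (zero {m}) b) +_) (∑-combine m n (λ i → f (n ↑ʳ i))))

∑-1ℙ : ∀ n → ∑[ i < n ] 1ℙ ≡ parity n
∑-1ℙ zero    = refl
∑-1ℙ (suc n) = trans (cong (1ℙ +_) (∑-1ℙ n)) (sym (ℙₚ.+-homo-+ 1 n))

∑-*0ℙ : ∀ n (f : Fin n → Parity) → ∑[ i < n ] (f i * 0ℙ) ≡ 0ℙ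
∑-*0ℙ n f = trans (sum-cong-≗ (ℙₚ.*-zeroʳ ∘ f)) (sum-replicate-zero n)

⌊suc≟suc⌋ : ∀ {k} (j i : Fin k) → ⌊ Fin.suc j ≟ suc i ⌋ ≡ ⌊ j ≟ i ⌋
⌊suc≟suc⌋ j i with j ≟ i
... | yes _ = refl
... | no  _ = refl

∑-*-indicator : ∀ {k} (g : Fin k → Parity) (j : Fin k) → ∑[ i < k ] (g i * toParity ⌊ j ≟ i ⌋) ≡ g j
∑-*-indicator {suc k} g zero = begin
  g zero * 1ℙ + ∑[ i < k ] (g (suc i) * 0ℙ) ≡⟨ cong₂ _+_ (ℙₚ.*-identityʳ (g zero)) (∑-*0ℙ k (g ∘ suc)) ⟩
  g zero + 0ℙ                               ≡⟨ ℙₚ.+-identityʳ (g zero) ⟩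
  g zero                                    ∎
∑-*-indicator {suc k} g (suc j) = begin
  g zero * 0ℙ + ∑[ i < k ] (g (suc i) * toParity ⌊ Fin.suc j ≟ suc i ⌋)
    ≡⟨ cong₂ _+_ (ℙₚ.*-zeroʳ (g zero)) (sum-cong-≗ λ i → cong (λ b → g (suc i) * toParity b) (⌊suc≟suc⌋ j i)) ⟩
  ∑[ i < k ] (g (suc i) * toParity ⌊ j ≟ i ⌋)
    ≡⟨ ∑-*-indicator (g ∘ suc) j ⟩
  g (suc j) ∎

-- The sum over Fin (2 + m) unfolds definitionally to (∑[ i < m ] parity (toℕ i)) ⁻¹.
∑-parity-toℕ : ∀ j → ∑[ i < 2 ℕ.+ 4 ℕ.* j ] parity (toℕ i) ≡ 1ℙ
∑-parity-toℕ zero    = refl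
∑-parity-toℕ (suc j) = begin
  ∑[ i < 2 ℕ.+ 4 ℕ.* suc j ] parity (toℕ i)     ≡⟨ cong (λ m → ∑[ i < 2 ℕ.+ m ] parity (toℕ i)) (ℕₚ.*-suc 4 j) ⟩
  (∑[ i < 2 ℕ.+ 4 ℕ.* j ] parity (toℕ i)) ⁻¹ ⁻¹ ≡⟨ cong (λ p → p ⁻¹ ⁻¹) (∑-parity-toℕ j) ⟩
  1ℙ                                             ∎

parity-length-filterᵇ : ∀ {A : Set} {k} (p : A → Bool) (g : Fin k → A) →
                        parity (length (filterᵇ p (tabulate g))) ≡ ∑[ i < k ] toParity (p (g i))
parity-length-filterᵇ {k = zero}  p g = refl
parity-length-filterᵇ {k = suc k} p g with p (g zero)
... | true  = trans (ℙₚ.+-homo-+ 1 (length (filterᵇ p (tabulate (g ∘ suc)))))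
                    (cong₂ _+_ refl (parity-length-filterᵇ p (g ∘ suc)))
... | false = parity-length-filterᵇ p (g ∘ suc)

∑-*-filterᵇ : ∀ {A : Set} {k} (p : A → Bool) (g : Fin k → A) (h : A → Parity) →
              ∑[ i < k ] (h (g i) * toParity (p (g i))) ≡ foldr (λ x → h x +_) 0ℙ (filterᵇ p (tabulate g))
∑-*-filterᵇ {k = zero}  p g h = refl
∑-*-filterᵇ {k = suc k} p g h with p (g zero)
... | true  = cong₂ _+_ (ℙₚ.*-identityʳ (h (g zero))) (∑-*-filterᵇ p (g ∘ suc) h)
... | false = cong₂ _+_ (ℙₚ.*-zeroʳ (h (g zero))) (∑-*-filterᵇ p (g ∘ suc) h)

length-filterᵇ-not : ∀ {A : Set} (p : A → Bool) (xs : List A) →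
                     length (filterᵇ p xs) ℕ.+ length (filterᵇ (not ∘ p) xs) ≡ length xs
length-filterᵇ-not p []       = refl
length-filterᵇ-not p (x ∷ xs) with p x
... | true  = cong suc (length-filterᵇ-not p xs)
... | false = trans (ℕₚ.+-suc _ _) (cong suc (length-filterᵇ-not p xs))

pair-support : ∀ {k} (p : Fin k → Bool) → length (filterᵇ p (allFin k)) ≡ 2 →
               ∃₂ λ a b → a ≢ b × (∀ g → ∑[ i < k ] (g i * toParity (p i)) ≡ g a + g b)
pair-support {k} p len
  with filterᵇ p (allFin k) | filter⁺ (T? ∘ p) (allFin⁺ k) | ∑-*-filterᵇ p id | len
... | a ∷ b ∷ [] | (a≢b All.∷ All.[]) AllPairs.∷ _ | ∑≡ | _ =
  a , b , a≢b , λ g → trans (∑≡ g) (cong (g a +_) (ℙₚ.+-identityʳ (g b)))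

length-filterᵇ-not≡2 : ∀ {k} (p : Fin k → Bool) → 2 ≤ k → length (filterᵇ p (allFin k)) ≡ k ∸ 2 →
                       length (filterᵇ (not ∘ p) (allFin k)) ≡ 2
length-filterᵇ-not≡2 {k} p 2≤k len = begin
  length rest                           ≡⟨ ℕₚ.m+n∸m≡n (length kept) (length rest) ⟨
  length kept ℕ.+ length rest ∸ length kept ≡⟨ cong₂ _∸_ total len ⟩
  k ∸ (k ∸ 2)                           ≡⟨ ℕₚ.m∸[m∸n]≡n 2≤k ⟩
  2                                     ∎
  where
  kept = filterᵇ p (allFin k)
  rest = filterᵇ (not ∘ p) (allFin k)
  total : length kept ℕ.+ length rest ≡ k
  total = trans (length-filterᵇ-not p (allFin k)) (length-tabulate id)

pair-cosupport : ∀ {k} (p : Fin k → Bool) → 2 ≤ k → length (filterᵇ p (allFin k)) ≡ k ∸ 2 →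
                 ∃₂ λ a b → a ≢ b × (∀ g → ∑[ i < k ] (g i * toParity (p i)) ≡ ∑[ i < k ] g i + (g a + g b))
pair-cosupport {k} p 2≤k len =
  let (a , b , a≢b , ∑≡) = pair-support (not ∘ p) (length-filterᵇ-not≡2 p 2≤k len) in
  a , b , a≢b , λ g → begin
    ∑[ i < k ] (g i * toParity (p i))                        ≡⟨ sum-cong-≗ (λ i → complement (g i) (p i)) ⟩
    ∑[ i < k ] (g i + (g i * toParity (not (p i))))          ≡⟨ ∑-distrib-+ g _ ⟩
    ∑[ i < k ] g i + ∑[ i < k ] (g i * toParity (not (p i))) ≡⟨ cong (∑[ i < k ] g i +_) (∑≡ g) ⟩
    ∑[ i < k ] g i + (g a + g b)                           ∎
  where
  complement : ∀ x b → x * toParity b ≡ x + (x * toParity (not b))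
  complement x true  = begin
    x * 1ℙ      ≡⟨ ℙₚ.*-identityʳ x ⟩
    x           ≡⟨ ℙₚ.+-identityʳ x ⟨
    x + 0ℙ      ≡⟨ cong (λ p → x + p) (ℙₚ.*-zeroʳ x) ⟨
    x + (x * 0ℙ) ∎
  complement x false = begin
    x * 0ℙ      ≡⟨ ℙₚ.*-zeroʳ x ⟩
    0ℙ          ≡⟨ ℙₚ.p+p≡0ℙ x ⟨
    x + x       ≡⟨ cong (λ p → x + p) (ℙₚ.*-identityʳ x) ⟨
    x + (x * 1ℙ) ∎

pair-support-or-cosupport : ∀ {k} (p : Fin k → Bool) → 2 ≤ k →
  length (filterᵇ p (allFin k)) ≡ 2 ⊎ length (filterᵇ p (allFin k)) ≡ k ∸ 2 →
  ∃₂ λ a b → a ≢ b × (∀ g → ∑[ i < k ] g i ≡ 0ℙ → ∑[ i < k ] (g i * toParity (p i)) ≡ g a + g b)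
pair-support-or-cosupport p _ (inj₁ two) =
  let (a , b , a≢b , ∑≡) = pair-support p two in
  a , b , a≢b , λ g _ → ∑≡ g
pair-support-or-cosupport p 2≤k (inj₂ allButTwo) =
  let (a , b , a≢b , ∑≡) = pair-cosupport p 2≤k allButTwo in
  a , b , a≢b , λ g ∑g≡0ℙ → trans (∑≡ g) (cong (_+ (g a + g b)) ∑g≡0ℙ)

module _ (A : AbelianGroup 0ℓ 0ℓ) where
  open AbelianGroup A using (Carrier; _∙_; ε; rawMonoid)
  open MonoidMorphisms rawMonoid ℙ.+-0-rawMonoid using (IsMonoidHomomorphism)

  IsCharacter : (Carrier → Parity) → Set
  IsCharacter = IsMonoidHomomorphism

  module _ {φ : Carrier → Parity} (φ-isCharacter : IsCharacter φ) where
    open IsMonoidHomomorphism φ-isCharacter using (homo; ε-homo)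

    character-foldr : ∀ {X : Set} {k} (t : X → Carrier) (g : Fin k → X) →
                      φ (foldr (λ x acc → t x ∙ acc) ε (tabulate g)) ≡ ∑[ i < k ] φ (t (g i))
    character-foldr {k = zero}  t g = ε-homo
    character-foldr {k = suc k} t g =
      trans (homo (t (g zero)) _) (cong (φ (t (g zero)) +_) (character-foldr t (g ∘ suc)))

handshake : ∀ {n} (b : Fin n → Fin n → Parity) → (∀ u v → b u v ≡ b v u) → (∀ v → b v v ≡ 0ℙ) →
            ∑[ u < n ] ∑[ v < n ] b u v ≡ 0ℙ
handshake {zero}  b b-sym b-diag = refl
handshake {suc n} b b-sym b-diag = begin
  (b zero zero + row) + ∑[ u < n ] (b (suc u) zero + ∑[ v < n ] b (suc u) (suc v))
    ≡⟨ cong₂ _+_ (cong (_+ row) (b-diag zero)) (∑-distrib-+ (λ u → b (suc u) zero) _) ⟩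
  row + (∑[ u < n ] b (suc u) zero + ∑[ u < n ] ∑[ v < n ] b (suc u) (suc v))
    ≡⟨ cong₂ (λ p q → row + (p + q)) (sum-cong-≗ λ u → b-sym (suc u) zero)
                                       (handshake (λ u v → b (suc u) (suc v)) (λ u v → b-sym (suc u) (suc v)) (b-diag ∘ suc)) ⟩
  row + (row + 0ℙ)
    ≡⟨ trans (cong (row +_) (ℙₚ.+-identityʳ row)) (ℙₚ.p+p≡0ℙ row) ⟩
  0ℙ ∎
  where row = ∑[ v < n ] b zero (suc v)

module _ {n} (G : Graph n) where

  ∑-∘-colouring : ∀ {k} (c : Fin n → Fin k) (g : Fin k → Parity) →
                  ∑[ v < n ] g (c v) ≡ ∑[ i < k ] (g i * parity (classSize G c i))
  ∑-∘-colouring {k} c g = begin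
    ∑[ v < n ] g (c v)                                       ≡⟨ sum-cong-≗ (λ v → ∑-*-indicator g (c v)) ⟨
    ∑[ v < n ] ∑[ i < k ] (g i * toParity ⌊ c v ≟ i ⌋)       ≡⟨ ∑-comm (λ v i → g i * toParity ⌊ c v ≟ i ⌋) ⟩
    ∑[ i < k ] ∑[ v < n ] (g i * toParity ⌊ c v ≟ i ⌋)       ≡⟨ sum-cong-≗ (λ i → *-distribˡ-sum (g i) (λ v → toParity ⌊ c v ≟ i ⌋)) ⟨
    ∑[ i < k ] (g i * ∑[ v < n ] toParity ⌊ c v ≟ i ⌋)       ≡⟨ sum-cong-≗ (λ i → cong (g i *_) (parity-length-filterᵇ (λ v → ⌊ c v ≟ i ⌋) id)) ⟨
    ∑[ i < k ] (g i * parity (classSize G c i))              ∎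

  module _ (A : AbelianGroup 0ℓ 0ℓ) where
    open AbelianGroup A using (Carrier; ε)

    ∑-character-weight≡0ℙ : ∀ {φ} → IsCharacter A φ → (f : Labelling G A) → ∑[ v < n ] φ (weight G A f v) ≡ 0ℙ
    ∑-character-weight≡0ℙ {φ} φ-isCharacter f =
      trans (sum-cong-≗ λ v → character-foldr A φ-isCharacter (edgeLabel v) id)
            (handshake (λ v u → φ (edgeLabel v u)) edgeLabel-sym edgeLabel-diag)
      where
      open Labelling f
      open MonoidMorphisms.IsMonoidHomomorphism φ-isCharacter using (ε-homo; ⟦⟧-cong)
      edgeLabel : Fin n → Fin n → Carrier
      edgeLabel v u = if adj G v u then lab v u else ε
      edgeLabel-sym : ∀ v u → φ (edgeLabel v u) ≡ φ (edgeLabel u v)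
      edgeLabel-sym v u rewrite Graph.sym G v u with adj G u v
      ... | true  = ⟦⟧-cong (lab-sym v u)
      ... | false = refl
      edgeLabel-diag : ∀ v → φ (edgeLabel v v) ≡ 0ℙ
      edgeLabel-diag v rewrite irrfl G v = ε-homo

    module _ {s} (A↔Fin : HasOrder G A s) where
      open Inverse A↔Fin using (to; from; strictlyInverseʳ)

      ParityBalanced : (Fin n → Fin s) → Set
      ParityBalanced c = ∀ {φ} → IsCharacter A φ → ∑[ i < s ] (φ (from i) * parity (classSize G c i)) ≡ 0ℙ

      weightColouring : Labelling G A → Fin n → Fin s
      weightColouring f = to ∘ weight G A f

      weightColouring-proper : ∀ f → IsVertexColouring G A f → Proper G s (weightColouring f)
      weightColouring-proper f f-colouring u v uv = f-colouring u v uv ∘ Injection.injective (Inverse⇒Injection A↔Fin)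

      weightColouring-balanced : ∀ f → ParityBalanced (weightColouring f)
      weightColouring-balanced f {φ} φ-isCharacter = begin
        ∑[ i < s ] (φ (from i) * parity (classSize G (weightColouring f) i)) ≡⟨ ∑-∘-colouring (weightColouring f) (φ ∘ from) ⟨
        ∑[ v < n ] φ (from (to (weight G A f v)))                            ≡⟨ sum-cong-≗ (λ v → ⟦⟧-cong (strictlyInverseʳ (weight G A f v))) ⟩
        ∑[ v < n ] φ (weight G A f v)                                        ≡⟨ ∑-character-weight≡0ℙ φ-isCharacter f ⟩
        0ℙ                                                                   ∎
        where open MonoidMorphisms.IsMonoidHomomorphism φ-isCharacter using (⟦⟧-cong)

      GoodOrder⇒balancedColouring : GoodOrder G s → ∃[ c ] Proper G s c × ParityBalanced c
      GoodOrder⇒balancedColouring good =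
        let (f , f-colouring) = good A A↔Fin in
        weightColouring f , weightColouring-proper f f-colouring , weightColouring-balanced f

-- The cyclic group ℤ/(k+1), on ℕ modulo k + 1

module Cyclic (k : ℕ) where
  private N = suc k

  _≡ₘ_ : ℕ → ℕ → Set
  x ≡ₘ y = x % N ≡ y % N

  -- k * x is the inverse of x since k * x + x = N * x.
  ℤ/N : AbelianGroup 0ℓ 0ℓ
  ℤ/N = record
    { Carrier = ℕ ; _≈_ = _≡ₘ_ ; _∙_ = ℕ._+_ ; ε = 0 ; _⁻¹ = k ℕ.*_
    ; isAbelianGroup = record
      { isGroup = record
        { isMonoid = record
          { isSemigroup = record
            { isMagma = record
              { isEquivalence = record { refl = refl ; sym = sym ; trans = trans }
              ; ∙-cong = λ {x} {y} {u} {v} x≡y u≡v → begin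
                  (x ℕ.+ u) % N             ≡⟨ %-distribˡ-+ x u N ⟩
                  (x % N ℕ.+ u % N) % N     ≡⟨ cong₂ (λ a b → (a ℕ.+ b) % N) x≡y u≡v ⟩
                  (y % N ℕ.+ v % N) % N     ≡⟨ %-distribˡ-+ y v N ⟨
                  (y ℕ.+ v) % N             ∎ }
            ; assoc = λ x y z → cong (_% N) (ℕₚ.+-assoc x y z) }
          ; identity = (λ x → refl) , (λ x → cong (_% N) (ℕₚ.+-identityʳ x)) }
        ; inverse = (λ x → trans (cong (_% N) (trans (ℕₚ.+-comm (k ℕ.* x) x) (ℕₚ.*-comm N x))) (m*n%n≡0 x N))
                  , (λ x → trans (cong (_% N) (ℕₚ.*-comm N x)) (m*n%n≡0 x N))
        ; ⁻¹-cong = λ {x} {y} x≡y → begin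
            (k ℕ.* x) % N                 ≡⟨ %-distribˡ-* k x N ⟩
            ((k % N) ℕ.* (x % N)) % N     ≡⟨ cong (λ a → ((k % N) ℕ.* a) % N) x≡y ⟩
            ((k % N) ℕ.* (y % N)) % N     ≡⟨ %-distribˡ-* k y N ⟨
            (k ℕ.* y) % N                 ∎ }
      ; comm = λ x y → cong (_% N) (ℕₚ.+-comm x y) } }

  toℕ-mod : ∀ x → toℕ (x mod N) ≡ x % N
  toℕ-mod x = toℕ-fromℕ< _

  ℤ/N↔Fin : Inverse (AbelianGroup.setoid ℤ/N) (setoid (Fin N))
  ℤ/N↔Fin = record
    { to        = _mod N
    ; from      = toℕ
    ; to-cong   = λ {x} {y} x≡y → toℕ-injective (trans (toℕ-mod x) (trans x≡y (sym (toℕ-mod y))))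
    ; from-cong = cong (λ i → toℕ i % N)
    ; inverse   = (λ {i} {x} x≡i → toℕ-injective (trans (toℕ-mod x) (trans x≡i (m<n⇒m%n≡m (toℕ<n i)))))
                , (λ {x} {i} i≡x → trans (cong (λ j → toℕ j % N) i≡x) (trans (cong (_% N) (toℕ-mod x)) (m%n%n≡m%n x N)))
    }

  parity-isCharacter : parity N ≡ 0ℙ → IsCharacter ℤ/N parity
  parity-isCharacter N-even = record
    { isMagmaHomomorphism = record
      { isRelHomomorphism = record
        { cong = λ {x} {y} x≡y → trans (sym (parity-% x N N-even)) (trans (cong parity x≡y) (parity-% y N N-even)) }
      ; homo = ℙₚ.+-homo-+ }
    ; ε-homo = refl }

-- The elementary Abelian group (ℤ/2)^q, on Fin q → Parity

finToParity : Fin 2 → Parity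
finToParity zero       = 0ℙ
finToParity (suc zero) = 1ℙ

parityToFin : Parity → Fin 2
parityToFin 0ℙ = zero
parityToFin 1ℙ = suc zero

parityToFin-finToParity : ∀ i → parityToFin (finToParity i) ≡ i
parityToFin-finToParity zero       = refl
parityToFin-finToParity (suc zero) = refl

finToParity-parityToFin : ∀ p → finToParity (parityToFin p) ≡ p
finToParity-parityToFin 0ℙ = refl
finToParity-parityToFin 1ℙ = refl

bits : ∀ q → Fin (2 ^ q) → Fin q → Parity
bits q i j = finToParity (finToFun {2} {q} i j)

funToFin-cong : ∀ {m n} {f g : Fin m → Fin n} → (∀ i → f i ≡ g i) → funToFin f ≡ funToFin g
funToFin-cong {zero}  f≗g = refl
funToFin-cong {suc m} f≗g = cong₂ combine (f≗g zero) (funToFin-cong (f≗g ∘ suc))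

module Elementary (q : ℕ) where

  ℤ/2^q : AbelianGroup 0ℓ 0ℓ
  ℤ/2^q = Pointwise.abelianGroup (Fin q) ℙₚ.+-0-abelianGroup

  ℤ/2^q↔Fin : Inverse (AbelianGroup.setoid ℤ/2^q) (setoid (Fin (2 ^ q)))
  ℤ/2^q↔Fin = record
    { to        = λ x → funToFin (parityToFin ∘ x)
    ; from      = bits q
    ; to-cong   = λ x≈y → funToFin-cong (cong parityToFin ∘ x≈y)
    ; from-cong = λ i≡j k → cong (λ i → bits q i k) i≡j
    ; inverse   = (λ {i} {x} x≈i → trans (funToFin-cong λ j → trans (cong parityToFin (x≈i j)) (parityToFin-finToParity (finToFun {2} i j)))
                                         (funToFin-finToFin {q} {2} i))
                , (λ {x} {i} i≡x j → trans (cong (λ i → bits q i j) i≡x)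
                                           (trans (cong finToParity (finToFun-funToFin (parityToFin ∘ x) j)) (finToParity-parityToFin (x j))))
    }

  coordinate-isCharacter : ∀ j → IsCharacter ℤ/2^q (λ x → x j)
  coordinate-isCharacter j = record
    { isMagmaHomomorphism = record { isRelHomomorphism = record { cong = λ x≈y → x≈y j } ; homo = λ _ _ → refl }
    ; ε-homo = refl }

-- Splitting Fin (2 ^ (q + 1)) as Fin 2 × Fin (2 ^ q), the first coordinate of (a, b) is a and
-- the others are those of b.
∑-coordinate : ∀ q (j : Fin (suc q)) → ∑[ i < 2 ^ suc q ] bits (suc q) i j ≡ parity (2 ^ q)
∑-coordinate q zero = begin
  ∑[ i < 2 ^ suc q ] bits (suc q) i zero
    ≡⟨ ∑-combine 2 (2 ^ q) (λ i → bits (suc q) i zero) ⟩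
  ∑[ a < 2 ] ∑[ b < 2 ^ q ] bits (suc q) (combine a b) zero
    ≡⟨ sum-cong-≗ {2} (λ a → sum-cong-≗ {2 ^ q} λ b → cong (finToParity ∘ proj₁) (remQuot-combine a b)) ⟩
  ∑[ b < 2 ^ q ] 0ℙ + (∑[ b < 2 ^ q ] 1ℙ + 0ℙ)
    ≡⟨ cong₂ _+_ (sum-replicate-zero (2 ^ q)) (trans (ℙₚ.+-identityʳ _) (∑-1ℙ (2 ^ q))) ⟩
  parity (2 ^ q) ∎
∑-coordinate (suc q) (suc j) = begin
  ∑[ i < 2 ^ suc (suc q) ] bits (suc (suc q)) i (suc j)
    ≡⟨ ∑-combine 2 (2 ^ suc q) (λ i → bits (suc (suc q)) i (suc j)) ⟩
  ∑[ a < 2 ] ∑[ b < 2 ^ suc q ] bits (suc (suc q)) (combine a b) (suc j)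
    ≡⟨ sum-cong-≗ {2} (λ a → sum-cong-≗ {2 ^ suc q} λ b → cong (λ rq → bits (suc q) (proj₂ rq) j) (remQuot-combine a b)) ⟩
  column + (column + 0ℙ)
    ≡⟨ trans (cong (column +_) (ℙₚ.+-identityʳ column)) (ℙₚ.p+p≡0ℙ column) ⟩
  0ℙ
    ≡⟨ parity-2^suc q ⟨
  parity (2 ^ suc q) ∎
  where column = ∑[ b < 2 ^ suc q ] bits (suc q) b j

module _ {n} (G : Graph n) where

  AllClassesOdd : ℕ → Set
  AllClassesOdd χ = ∀ c → Proper G χ c → ∀ i → classSize G c i % 2 ≡ 1

  TwoOrAllButTwoClassesOdd : ℕ → ℕ → Set
  TwoOrAllButTwoClassesOdd q χ = ∀ c → Proper G χ c → oddClasses G c ≡ 2 ⊎ oddClasses G c ≡ 2 ^ q ∸ 2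

  GoodOrder⇒Colourable : ∀ s → 1 ≤ s → GoodOrder G s → Colourable G s
  GoodOrder⇒Colourable (suc k) _ good =
    let open Cyclic k
        (c , c-proper , _) = GoodOrder⇒balancedColouring G ℤ/N ℤ/N↔Fin good
    in c , c-proper

  allClassesOdd⇒¬GoodOrder : ∀ j → AllClassesOdd (2 ℕ.+ 4 ℕ.* j) → ¬ GoodOrder G (2 ℕ.+ 4 ℕ.* j)
  allClassesOdd⇒¬GoodOrder j allOdd good =
    let open Cyclic (suc (4 ℕ.* j))
        (c , c-proper , c-balanced) = GoodOrder⇒balancedColouring G ℤ/N ℤ/N↔Fin good
        odd : ∀ i → parity (toℕ i) * parity (classSize G c i) ≡ parity (toℕ i)
        odd i = trans (cong (parity (toℕ i) *_) (odd⇒parity≡1ℙ (classSize G c i) (allOdd c c-proper i))) (ℙₚ.*-identityʳ _)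
    in 1ℙ≢0ℙ (begin
      1ℙ                                                                  ≡⟨ ∑-parity-toℕ j ⟨
      ∑[ i < 2 ℕ.+ 4 ℕ.* j ] parity (toℕ i)                               ≡⟨ sum-cong-≗ odd ⟨
      ∑[ i < 2 ℕ.+ 4 ℕ.* j ] (parity (toℕ i) * parity (classSize G c i)) ≡⟨ c-balanced (parity-isCharacter (ℙₚ.*-homo-* 4 j)) ⟩
      0ℙ                                                                  ∎)
    where
    1ℙ≢0ℙ : 1ℙ ≢ 0ℙ
    1ℙ≢0ℙ ()

  twoOrAllButTwoClassesOdd⇒¬GoodOrder : ∀ q → TwoOrAllButTwoClassesOdd (2 ℕ.+ q) (2 ^ (2 ℕ.+ q)) →
                                         ¬ GoodOrder G (2 ^ (2 ℕ.+ q))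
  twoOrAllButTwoClassesOdd⇒¬GoodOrder q twoOrAllButTwo good =
    let open Elementary (2 ℕ.+ q)
        (c , c-proper , c-balanced) = GoodOrder⇒balancedColouring G ℤ/2^q ℤ/2^q↔Fin good
        odd : Fin (2 ^ (2 ℕ.+ q)) → Bool
        odd i = ⌊ classSize G c i % 2 ℕₚ.≟ 1 ⌋
        (a , b , a≢b , ∑≡) = pair-support-or-cosupport odd (2≤2^suc (suc q)) (twoOrAllButTwo c c-proper)
        bits-agree : ∀ j → bits _ a j ≡ bits _ b j
        bits-agree j = +≡0ℙ⇒≡ (begin
          bits _ a j + bits _ b j
            ≡⟨ ∑≡ (λ i → bits _ i j) (trans (∑-coordinate (suc q) j) (parity-2^suc q)) ⟨
          ∑[ i < 2 ^ (2 ℕ.+ q) ] (bits _ i j * toParity (odd i))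
            ≡⟨ sum-cong-≗ (λ i → cong (bits _ i j *_) (toParity-odd (classSize G c i))) ⟩
          ∑[ i < 2 ^ (2 ℕ.+ q) ] (bits _ i j * parity (classSize G c i))
            ≡⟨ c-balanced (coordinate-isCharacter j) ⟩
          0ℙ ∎)
    in a≢b (Injection.injective (Inverse⇒Injection (Symmetry.inverse ℤ/2^q↔Fin)) bits-agree)

  ugly⇒¬GoodOrder : ∀ χ → (∃[ j ] χ ≡ 4 ℕ.* j ℕ.+ 2 × AllClassesOdd χ)
                        ⊎ (∃[ q ] 2 ≤ q × χ ≡ 2 ^ q × TwoOrAllButTwoClassesOdd q χ) →
                    ¬ GoodOrder G χ
  ugly⇒¬GoodOrder _ (inj₁ (j , refl , allOdd)) =
    subst (λ χ → AllClassesOdd χ → ¬ GoodOrder G χ) (ℕₚ.+-comm 2 (4 ℕ.* j)) (allClassesOdd⇒¬GoodOrder j) allOdd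
  ugly⇒¬GoodOrder _ (inj₂ (suc (suc q) , s≤s (s≤s z≤n) , refl , twoOrAllButTwo)) =
    twoOrAllButTwoClassesOdd⇒¬GoodOrder q twoOrAllButTwo

lemma2p1 : ∀ (n : ℕ) (G : Graph n) → Ugly G →
           ∀ χ → IsChromaticNumber G χ →
           ∀ s → IsGroupSumChromaticNumber G s → suc χ ≤ s
lemma2p1 _ G (_ , _ , χ′ , χ′-chromatic , ugly) χ χ-chromatic s (1≤s , good , _) =
  ℕₚ.≤∧≢⇒< (proj₂ χ-chromatic s (GoodOrder⇒Colourable G s 1≤s good)) χ≢s
  where
  χ′≡χ : χ′ ≡ χ
  χ′≡χ = ℕₚ.≤-antisym (proj₂ χ′-chromatic χ (proj₁ χ-chromatic)) (proj₂ χ-chromatic χ′ (proj₁ χ′-chromatic))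
  χ≢s : χ ≢ s
  χ≢s χ≡s = ugly⇒¬GoodOrder G χ′ ugly (subst (GoodOrder G) (sym (trans χ′≡χ χ≡s)) good)
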